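{- Let $q\ge 2$, $M>m\ge 0$, $\ell\le u$ and $n_0\ge \max\{ -\ell/q^m,0\}$ be integers, and let $x\colon\mathbb{N}_0\to\mathbb{C}$ be a sequence for which there are constants $c_{s,k}\in\mathbb{C}$ ($0\le s<q^M$, $\ell\le k\le u$) with \[x(q^Mn+s)=\sum_{\ell\le k\le u}c_{s,k}\,x(q^mn+k)\qquad\text{for all } n\ge n_0,\ 0\le s<q^M.\] Then $x$ is $q$-regular.
   Context: A sequence $x\colon\mathbb{N}_0\to\mathbb{C}$ is $q$-regular if the $\mathbb{C}$-vector space spanned by $\{n\mapsto x(q^jn+r): j\ge0,\ 0\le r<q^j\}$ is finite-dimensional; equivalently, there exist $D\in\mathbb{N}$, $v\colon\mathbb{N}_0\to\mathbb{C}^D$ with first component $x$, and matrices $A_0,\dots,A_{q-1}$ with $v(qn+r)=A_rv(n)$ for all $0\le r<q$, $n\ge0$. -}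

module Defs where

open import Level using (Level)
open import Algebra.Bundles using (CommutativeRing)
open import Data.Nat as ℕ using (ℕ; zero; suc; _<_)
open import Data.Fin using (Fin; zero; suc; toℕ)
open import Data.Integer as ℤ using (ℤ; +_; -[1+_]; ∣_∣)
open import Data.Product using (Σ; ∃; _×_)

module _ {c ℓ : Level} (R : CommutativeRing c ℓ) where
  open CommutativeRing R using (Carrier; _≈_; _+_; _*_; 0#)

  sumFin : (n : ℕ) → (Fin n → Carrier) → Carrier
  sumFin zero    f = 0#
  sumFin (suc n) f = f zero + sumFin n (λ i → f (suc i))

  -- Σ_{lo ≤ k ≤ hi} f k   (meant for lo ≤ hi; k = lo + i, 0 ≤ i ≤ hi - lo)
  sumℤRange : ℤ → ℤ → (ℤ → Carrier) → Carrier
  sumℤRange lo hi f = sumFin (suc ∣ hi ℤ.- lo ∣) (λ i → f (lo ℤ.+ + toℕ i))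

  -- a sequence on ℕ₀ read at an integer index; only used at indices ≥ 0
  atℤ : (ℕ → Carrier) → ℤ → Carrier
  atℤ x (+ n)    = x n
  atℤ x -[1+ n ] = 0#

  -- q-regularity via linear representation: D ∈ ℕ (D ≥ 1), v : ℕ₀ → R^D with
  -- first component x, matrices A_0..A_{q-1} with v(qn+r) = A_r v(n).
  IsRegular : (q : ℕ) → (ℕ → Carrier) → Set (c Level.⊔ ℓ)
  IsRegular q x =
    Σ ℕ λ D →
    Σ (ℕ → Fin (suc D) → Carrier) λ v →
    Σ (Fin q → Fin (suc D) → Fin (suc D) → Carrier) λ A →
      (∀ n → v n zero ≈ x n) ×
      (∀ (r : Fin q) n (i : Fin (suc D)) →
        v (q ℕ.* n ℕ.+ toℕ r) i ≈ sumFin (suc D) (λ j → A r i j * v n j))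

-- Delaying x by q^M |l| turns the recurrence into one for a sequence y with natural offsets L + i.
-- The sequences n ↦ y (q^j n + r), j ≤ M, r ≤ q^j + 2H (H a constant), together with the unit
-- sequences δ_b below the threshold of the recurrence, span a space closed under the decimations
-- g ↦ (n ↦ g (q n + a)), a < q: decimating raises j by one, and at level M the recurrence rewrites
-- y (q^M n + r) as a combination of level-m sequences with offsets at most q^m + 2H, except at
-- finitely many n, which the δ_b absorb.  A finite family closed under decimation is a linear
-- representation.

module Submission where

open import Function using (_∘_)
open import Level using (Level; _⊔_)
open import Algebra.Bundles using (CommutativeRing)
open import Data.Empty using (⊥-elim)
open import Data.Fin using (Fin; zero; suc; toℕ; fromℕ<; combine; remQuot; _↑ˡ_; _↑ʳ_)
import Data.Fin.Properties as Fin
open import Data.Integer as ℤ using (ℤ; +_; -[1+_]; _⊖_)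
import Data.Integer.Properties as ℤ
import Data.Integer.Tactic.RingSolver as ℤ-Solver
open import Data.Nat as ℕ using (ℕ; zero; suc; _∸_; _<_; _≤_; _^_; z≤n; s≤s)
open import Data.Nat.DivMod using (_/_; _%_; m≡m%n+[m/n]*n; m%n<n; m/n*n≤m)
import Data.Nat.Properties as ℕ
open import Data.Nat.Tactic.RingSolver using (solve-∀)
open import Data.Product using (Σ; _,_; proj₁; proj₂; uncurry)
open import Data.Sum using (inj₁; inj₂)
open import Data.Vec.Functional using (Vector; _∷_; _++_; concat)
open import Data.Vec.Functional.Properties using (lookup-++ˡ; lookup-++ʳ)
open import Data.Vec.Functional.Relation.Unary.All using (All)
open import Data.Vec.Functional.Relation.Unary.All.Properties using (++⁺)
open import Relation.Binary.PropositionalEquality as ≡ using (_≡_)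
open import Relation.Nullary using (yes; no)

open import Defs

module Spans {c ℓ : Level} (R : CommutativeRing c ℓ) where
  open CommutativeRing R hiding (zero)
  open import Algebra.Properties.Semiring.Sum semiring
  open import Algebra.Properties.Group +-group using (//-rightDividesˡ; x≈y⇒x∙y⁻¹≈ε)
  open import Relation.Binary.Reasoning.Setoid setoid

  sumFin≡sum : ∀ n (f : Fin n → Carrier) → sumFin R n f ≡ sum f
  sumFin≡sum zero    f = ≡.refl
  sumFin≡sum (suc n) f = ≡.cong (λ s → f zero + s) (sumFin≡sum n (λ i → f (suc i)))

  Span : ∀ {K} → Vector (ℕ → Carrier) K → (ℕ → Carrier) → Set (c ⊔ ℓ)
  Span {K} F g = Σ (Fin K → Carrier) λ a → ∀ n → g n ≈ ∑[ j < K ] (a j * F j n)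

  module _ {K} {F : Vector (ℕ → Carrier) K} where

    Span-resp : ∀ {g h} → (∀ n → g n ≈ h n) → Span F h → Span F g
    Span-resp g≈h (a , h≈) = a , λ n → trans (g≈h n) (h≈ n)

    Span-0 : Span F (λ _ → 0#)
    Span-0 = (λ _ → 0#) , λ n → sym (begin
      ∑[ j < K ] (0# * F j n) ≈⟨ sum-cong-≋ (λ j → zeroˡ (F j n)) ⟩
      ∑[ j < K ] 0#           ≈⟨ sum-replicate-zero K ⟩
      0#                      ∎)

    Span-+ : ∀ {g h} → Span F g → Span F h → Span F (λ n → g n + h n)
    Span-+ (a , g≈) (b , h≈) = (λ j → a j + b j) , λ n → begin
      _                                                   ≈⟨ +-cong (g≈ n) (h≈ n) ⟩
      ∑[ j < K ] (a j * F j n) + ∑[ j < K ] (b j * F j n)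
        ≈⟨ ∑-distrib-+ (λ j → a j * F j n) (λ j → b j * F j n) ⟨
      ∑[ j < K ] (a j * F j n + b j * F j n)
        ≈⟨ sum-cong-≋ (λ j → distribʳ (F j n) (a j) (b j)) ⟨
      ∑[ j < K ] ((a j + b j) * F j n)                    ∎

    Span-* : ∀ x {g} → Span F g → Span F (λ n → x * g n)
    Span-* x (a , g≈) = (λ j → x * a j) , λ n → begin
      x * _                            ≈⟨ *-congˡ (g≈ n) ⟩
      x * ∑[ j < K ] (a j * F j n)     ≈⟨ *-distribˡ-sum x (λ j → a j * F j n) ⟩
      ∑[ j < K ] (x * (a j * F j n))   ≈⟨ sum-cong-≋ (λ j → *-assoc x (a j) (F j n)) ⟨
      ∑[ j < K ] (x * a j * F j n)     ∎

    Span-∑ : ∀ W (g : Fin W → ℕ → Carrier) → (∀ i → Span F (g i)) →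
             Span F (λ n → ∑[ i < W ] g i n)
    Span-∑ zero    g g∈ = Span-0
    Span-∑ (suc W) g g∈ = Span-+ (g∈ zero) (Span-∑ W (λ i → g (suc i)) (λ i → g∈ (suc i)))

  Span-∷ : ∀ {K} {F : Vector (ℕ → Carrier) K} {g} h → Span F g → Span (h ∷ F) g
  Span-∷ h (a , g≈) = (0# ∷ a) , λ n →
    trans (g≈ n) (sym (trans (+-congʳ (zeroˡ (h n))) (+-identityˡ _)))

  Span-basis : ∀ {K} {F : Vector (ℕ → Carrier) K} i → Span F (F i)
  Span-basis {suc K} {F} zero = (1# ∷ λ _ → 0#) , λ n → sym (begin
    1# * F zero n + ∑[ j < K ] (0# * F (suc j) n) ≈⟨ +-congʳ (*-identityˡ (F zero n)) ⟩
    F zero n + ∑[ j < K ] (0# * F (suc j) n)      ≈⟨ +-congˡ (sym (proj₂ (Span-0 {F = F ∘ suc}) n)) ⟩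
    F zero n + 0#                                 ≈⟨ +-identityʳ (F zero n) ⟩
    F zero n                                      ∎)
  Span-basis {suc K} {F} (suc i) = Span-∷ (F zero) (Span-basis i)

  δ : ℕ → ℕ → Carrier
  δ zero    zero    = 1#
  δ zero    (suc n) = 0#
  δ (suc b) zero    = 0#
  δ (suc b) (suc n) = δ b n

  δ-diag : ∀ b → δ b b ≡ 1#
  δ-diag zero    = ≡.refl
  δ-diag (suc b) = δ-diag b

  δ-< : ∀ {b n} → b < n → δ b n ≡ 0#
  δ-< {zero}  {suc n} _         = ≡.refl
  δ-< {suc b} {suc n} (s≤s b<n) = δ-< b<n

  Span-finiteSupport : ∀ {K} {F : Vector (ℕ → Carrier) K} B → (∀ b → b < B → Span F (δ b)) →
                       ∀ {g} → (∀ n → B ≤ n → g n ≈ 0#) → Span F g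
  Span-finiteSupport zero    δ∈ g≈0 = Span-resp (λ n → g≈0 n z≤n) Span-0
  Span-finiteSupport (suc B) δ∈ {g} g≈0 =
    Span-resp (λ n → sym (//-rightDividesˡ (g B * δ B n) (g n)))
      (Span-+ (Span-finiteSupport B (λ b b<B → δ∈ b (ℕ.m<n⇒m<1+n b<B))
                 (λ n B≤n → x≈y⇒x∙y⁻¹≈ε (g≈gBδB n B≤n)))
              (Span-* (g B) (δ∈ B ℕ.≤-refl)))
    where
    g≈gBδB : ∀ n → B ≤ n → g n ≈ g B * δ B n
    g≈gBδB n B≤n with ℕ.m≤n⇒m<n∨m≡n B≤n
    ... | inj₁ B<n    = trans (g≈0 n B<n) (sym (trans (*-congˡ (reflexive (δ-< B<n))) (zeroʳ (g B))))
    ... | inj₂ ≡.refl = sym (trans (*-congˡ (reflexive (δ-diag B))) (*-identityʳ (g B)))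

  Span-eventually : ∀ {K} {F : Vector (ℕ → Carrier) K} B → (∀ b → b < B → Span F (δ b)) →
                    ∀ {g h} → Span F h → (∀ n → B ≤ n → g n ≈ h n) → Span F g
  Span-eventually B δ∈ {g} {h} h∈ g≈h = Span-resp (λ n → sym (//-rightDividesˡ (h n) (g n)))
    (Span-+ (Span-finiteSupport B δ∈ (λ n B≤n → x≈y⇒x∙y⁻¹≈ε (g≈h n B≤n))) h∈)

module Decimations {c ℓ : Level} (R : CommutativeRing c ℓ) (q : ℕ) where
  open CommutativeRing R hiding (zero)
  open Spans R

  DecimationsIn : ∀ {K} → Vector (ℕ → Carrier) K → (ℕ → Carrier) → Set (c ⊔ ℓ)
  DecimationsIn F g = ∀ (r : Fin q) → Span F (λ n → g (q ℕ.* n ℕ.+ toℕ r))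

  Closed : ∀ {K} → Vector (ℕ → Carrier) K → Set (c ⊔ ℓ)
  Closed F = All (DecimationsIn F) F

  Span-decimations : ∀ {K} {F : Vector (ℕ → Carrier) K} → Closed F →
                     ∀ {g} → Span F g → DecimationsIn F g
  Span-decimations {K} closed (a , g≈) r =
    Span-resp (λ n → g≈ _) (Span-∑ K _ (λ j → Span-* (a j) (closed j r)))

  isRegular-Span : ∀ {K} {F : Vector (ℕ → Carrier) K} → Closed F →
                   ∀ {x} → Span F x → IsRegular R q x
  isRegular-Span {K} {F} closed {x} x∈ =
    K , (λ n j → (x ∷ F) j n) , (λ r i → proj₁ (closed′ i r)) , (λ n → refl) ,
    λ r n i → trans (proj₂ (closed′ i r) n)
                    (reflexive (≡.sym (sumFin≡sum (suc K) (λ j → proj₁ (closed′ i r) j * (x ∷ F) j n))))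
    where
    closed′ : Closed (x ∷ F)
    closed′ zero    r = Span-∷ x (Span-decimations closed x∈ r)
    closed′ (suc i) r = Span-∷ x (closed i r)

m*t≤m+h : ∀ {m b h} t → 2 ℕ.* m ≤ b → t ℕ.* b ≤ b ℕ.+ 2 ℕ.* h → m ℕ.* t ≤ m ℕ.+ h
m*t≤m+h {m} zero    _    _  = ℕ.≤-trans (ℕ.≤-reflexive (ℕ.*-zeroʳ m)) z≤n
m*t≤m+h {m} {b} {h} (suc t) 2m≤b tb≤ = begin
  m ℕ.* suc t   ≡⟨ ℕ.*-suc m t ⟩
  m ℕ.+ m ℕ.* t ≤⟨ ℕ.+-monoʳ-≤ m (ℕ.*-cancelˡ-≤ 2 2mt≤2h) ⟩
  m ℕ.+ h       ∎
  where
  open ℕ.≤-Reasoning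
  2mt≤2h : 2 ℕ.* (m ℕ.* t) ≤ 2 ℕ.* h
  2mt≤2h = begin
    2 ℕ.* (m ℕ.* t) ≡⟨ ℕ.*-assoc 2 m t ⟨
    2 ℕ.* m ℕ.* t   ≤⟨ ℕ.*-monoˡ-≤ t 2m≤b ⟩
    b ℕ.* t         ≡⟨ ℕ.*-comm b t ⟩
    t ℕ.* b         ≤⟨ ℕ.+-cancelˡ-≤ b _ _ tb≤ ⟩
    2 ℕ.* h         ∎

module NaturalRecurrence {c ℓ : Level} (R : CommutativeRing c ℓ)
  {q M m L W n₁ : ℕ} (2≤q : 2 ≤ q) (m<M : m < M)
  (y : ℕ → CommutativeRing.Carrier R) (d : ℕ → Fin (suc W) → CommutativeRing.Carrier R)
  (rec : ∀ n s → n₁ ≤ n → s < q ^ M →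
     CommutativeRing._≈_ R (y (q ^ M ℕ.* n ℕ.+ s))
       (sumFin R (suc W) (λ i → CommutativeRing._*_ R (d s i) (y (q ^ m ℕ.* n ℕ.+ L ℕ.+ toℕ i)))))
  (r₀ : ℕ)
  where
  open CommutativeRing R hiding (zero)
  open Spans R
  open Decimations R q
  open import Algebra.Properties.Semiring.Sum semiring using (sum; sum-syntax; sum-cong-≗)

  instance
    q≢0 : ℕ.NonZero q
    q≢0 = ℕ.>-nonZero (ℕ.<-≤-trans (s≤s z≤n) 2≤q)

  seq : ℕ → ℕ → ℕ → Carrier
  seq j r n = y (q ^ j ℕ.* n ℕ.+ r)

  H : ℕ
  H = L ℕ.+ W ℕ.+ r₀

  -- The slack 2H absorbs the level-m offsets q^m t + L + i created in Span-seqᴹ, as q^m t ≤ q^m + H.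
  bound : ℕ → ℕ
  bound j = q ^ j ℕ.+ 2 ℕ.* H

  -- Zero outside the window r ≤ bound j, so that the family can be indexed by a rectangle.
  guarded : ℕ → ℕ → ℕ → Carrier
  guarded j r with r ℕ.≤? bound j
  ... | yes _ = seq j r
  ... | no  _ = λ _ → 0#

  guarded-≤ : ∀ {j r} → r ≤ bound j → guarded j r ≡ seq j r
  guarded-≤ {j} {r} r≤ with r ℕ.≤? bound j
  ... | yes _  = ≡.refl
  ... | no r≰ = ⊥-elim (r≰ r≤)

  guardeds : Vector (Vector (ℕ → Carrier) (suc (bound M))) M
  guardeds j r = guarded (toℕ j) (toℕ r)

  deltas : Vector (ℕ → Carrier) n₁
  deltas b = δ (toℕ b)

  F : Vector (ℕ → Carrier) (M ℕ.* suc (bound M) ℕ.+ n₁)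
  F = concat guardeds ++ deltas

  Span-δ : ∀ b → b < n₁ → Span F (δ b)
  Span-δ b b<n₁ = ≡.subst (Span F) F≡δb (Span-basis (M ℕ.* suc (bound M) ↑ʳ fromℕ< b<n₁))
    where
    F≡δb : F (M ℕ.* suc (bound M) ↑ʳ fromℕ< b<n₁) ≡ δ b
    F≡δb = ≡.trans (lookup-++ʳ (concat guardeds) deltas (fromℕ< b<n₁))
                   (≡.cong δ (Fin.toℕ-fromℕ< b<n₁))

  Span-guarded : ∀ {j r} → j < M → r ≤ bound M → Span F (guarded j r)
  Span-guarded {j} {r} j<M r≤ = ≡.subst (Span F) F≡guarded (Span-basis (combine j′ r′ ↑ˡ n₁))
    where
    j′ = fromℕ< j<M
    r′ = fromℕ< (s≤s r≤)
    F≡guarded : F (combine j′ r′ ↑ˡ n₁) ≡ guarded j r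
    F≡guarded = begin
      F (combine j′ r′ ↑ˡ n₁)         ≡⟨ lookup-++ˡ (concat guardeds) deltas (combine j′ r′) ⟩
      concat guardeds (combine j′ r′) ≡⟨ ≡.cong (uncurry guardeds) (Fin.remQuot-combine j′ r′) ⟩
      guardeds j′ r′                  ≡⟨ ≡.cong₂ guarded (Fin.toℕ-fromℕ< j<M) (Fin.toℕ-fromℕ< (s≤s r≤)) ⟩
      guarded j r                     ∎
      where open ≡.≡-Reasoning

  bound-mono : ∀ {j k} → j ≤ k → bound j ≤ bound k
  bound-mono j≤k = ℕ.+-monoˡ-≤ (2 ℕ.* H) (ℕ.^-monoʳ-≤ q j≤k)

  seq-decimation : ∀ j r a n → seq j r (q ℕ.* n ℕ.+ a) ≡ seq (suc j) (q ^ j ℕ.* a ℕ.+ r) n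
  seq-decimation j r a n = ≡.cong y (index (q ^ j) q n a r)
    where
    index : ∀ k q n a r → k ℕ.* (q ℕ.* n ℕ.+ a) ℕ.+ r ≡ q ℕ.* k ℕ.* n ℕ.+ (k ℕ.* a ℕ.+ r)
    index = solve-∀

  decimation-bound : ∀ {j r a} → r ≤ bound j → a < q → q ^ j ℕ.* a ℕ.+ r ≤ bound (suc j)
  decimation-bound {j} {r} {a} r≤ a<q = begin
    q ^ j ℕ.* a ℕ.+ r                 ≤⟨ ℕ.+-monoʳ-≤ (q ^ j ℕ.* a) r≤ ⟩
    q ^ j ℕ.* a ℕ.+ (q ^ j ℕ.+ 2 ℕ.* H) ≡⟨ regroup (q ^ j) a (2 ℕ.* H) ⟩
    q ^ j ℕ.* suc a ℕ.+ 2 ℕ.* H        ≤⟨ ℕ.+-monoˡ-≤ (2 ℕ.* H) (ℕ.*-monoʳ-≤ (q ^ j) a<q) ⟩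
    q ^ j ℕ.* q ℕ.+ 2 ℕ.* H            ≡⟨ ≡.cong (ℕ._+ 2 ℕ.* H) (ℕ.*-comm (q ^ j) q) ⟩
    bound (suc j)                     ∎
    where
    open ℕ.≤-Reasoning
    regroup : ∀ k a h → k ℕ.* a ℕ.+ (k ℕ.+ h) ≡ k ℕ.* suc a ℕ.+ h
    regroup = solve-∀

  Span-seq< : ∀ {j r} → j < M → r ≤ bound j → Span F (seq j r)
  Span-seq< j<M r≤ = ≡.subst (Span F) (guarded-≤ r≤)
    (Span-guarded j<M (ℕ.≤-trans r≤ (bound-mono (ℕ.<⇒≤ j<M))))

  Span-seqᴹ : ∀ {r} → r ≤ bound M → Span F (seq M r)
  Span-seqᴹ {r} r≤ =
    Span-eventually n₁ Span-δ
      (Span-∑ (suc W) _ (λ i → Span-* (d s i) (Span-seq< m<M (offset≤ (toℕ i) (Fin.toℕ≤pred[n] i)))))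
      agree
    where
    instance
      qᴹ≢0 : ℕ.NonZero (q ^ M)
      qᴹ≢0 = ℕ.m^n≢0 q M
    t s : ℕ
    t = r / q ^ M
    s = r % q ^ M

    offset≤ : ∀ i → i ≤ W → q ^ m ℕ.* t ℕ.+ L ℕ.+ i ≤ bound m
    offset≤ i i≤W = begin
      q ^ m ℕ.* t ℕ.+ L ℕ.+ i     ≤⟨ ℕ.+-mono-≤ (ℕ.+-monoˡ-≤ L qᵐt≤) i≤W ⟩
      q ^ m ℕ.+ H ℕ.+ L ℕ.+ W     ≡⟨ regroup (q ^ m) H L W ⟩
      q ^ m ℕ.+ (H ℕ.+ (L ℕ.+ W)) ≤⟨ ℕ.+-monoʳ-≤ (q ^ m) (ℕ.+-monoʳ-≤ H (ℕ.m≤m+n (L ℕ.+ W) r₀)) ⟩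
      q ^ m ℕ.+ (H ℕ.+ H)         ≡⟨ ≡.cong (λ h → q ^ m ℕ.+ (H ℕ.+ h)) (ℕ.+-identityʳ H) ⟨
      bound m                     ∎
      where
      open ℕ.≤-Reasoning
      regroup : ∀ a h l w → a ℕ.+ h ℕ.+ l ℕ.+ w ≡ a ℕ.+ (h ℕ.+ (l ℕ.+ w))
      regroup = solve-∀
      qᵐt≤ : q ^ m ℕ.* t ≤ q ^ m ℕ.+ H
      qᵐt≤ = m*t≤m+h {q ^ m} {q ^ M} {H} t
               (ℕ.≤-trans (ℕ.*-monoˡ-≤ (q ^ m) 2≤q) (ℕ.^-monoʳ-≤ q m<M))
               (ℕ.≤-trans (m/n*n≤m r (q ^ M)) r≤)

    agree : ∀ n → n₁ ≤ n →
            seq M r n ≈ ∑[ i < suc W ] (d s i * seq m (q ^ m ℕ.* t ℕ.+ L ℕ.+ toℕ i) n)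
    agree n n₁≤n = begin
      seq M r n
        ≡⟨ ≡.cong (λ r → y (q ^ M ℕ.* n ℕ.+ r)) (m≡m%n+[m/n]*n r (q ^ M)) ⟩
      y (q ^ M ℕ.* n ℕ.+ (s ℕ.+ t ℕ.* q ^ M))
        ≡⟨ ≡.cong y (split (q ^ M) n s t) ⟩
      y (q ^ M ℕ.* (n ℕ.+ t) ℕ.+ s)
        ≈⟨ rec (n ℕ.+ t) s (ℕ.≤-trans n₁≤n (ℕ.m≤m+n n t)) (m%n<n r (q ^ M)) ⟩
      sumFin R (suc W) (λ i → d s i * y (q ^ m ℕ.* (n ℕ.+ t) ℕ.+ L ℕ.+ toℕ i))
        ≡⟨ sumFin≡sum (suc W) (λ i → d s i * y (q ^ m ℕ.* (n ℕ.+ t) ℕ.+ L ℕ.+ toℕ i)) ⟩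
      ∑[ i < suc W ] (d s i * y (q ^ m ℕ.* (n ℕ.+ t) ℕ.+ L ℕ.+ toℕ i))
        ≡⟨ sum-cong-≗ (λ i → ≡.cong (λ k → d s i * y k) (unfold (q ^ m) n t L (toℕ i))) ⟩
      ∑[ i < suc W ] (d s i * seq m (q ^ m ℕ.* t ℕ.+ L ℕ.+ toℕ i) n)
        ∎
      where
      open import Relation.Binary.Reasoning.Setoid setoid
      split : ∀ Q n s t → Q ℕ.* n ℕ.+ (s ℕ.+ t ℕ.* Q) ≡ Q ℕ.* (n ℕ.+ t) ℕ.+ s
      split = solve-∀
      unfold : ∀ Q n t L i → Q ℕ.* (n ℕ.+ t) ℕ.+ L ℕ.+ i ≡ Q ℕ.* n ℕ.+ (Q ℕ.* t ℕ.+ L ℕ.+ i)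
      unfold = solve-∀

  Span-seq : ∀ {j r} → j ≤ M → r ≤ bound j → Span F (seq j r)
  Span-seq j≤M r≤ with ℕ.m≤n⇒m<n∨m≡n j≤M
  ... | inj₁ j<M    = Span-seq< j<M r≤
  ... | inj₂ ≡.refl = Span-seqᴹ r≤

  guarded-decimations : ∀ j r → j < M → DecimationsIn F (guarded j r)
  guarded-decimations j r j<M a with r ℕ.≤? bound j
  ... | yes r≤ = Span-resp (λ n → reflexive (seq-decimation j r (toℕ a) n))
                   (Span-seq j<M (decimation-bound {j} r≤ (Fin.toℕ<n a)))
  ... | no  _  = Span-0

  δ-decimations : ∀ b → b < n₁ → DecimationsIn F (δ b)
  δ-decimations b b<n₁ a = Span-finiteSupport n₁ Span-δ λ n n₁≤n →
    reflexive (δ-< (ℕ.<-≤-trans b<n₁ (ℕ.≤-trans n₁≤n n≤qn+a)))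
    where
    n≤qn+a : ∀ {n} → n ≤ q ℕ.* n ℕ.+ toℕ a
    n≤qn+a {n} = ℕ.≤-trans (ℕ.m≤n*m n q) (ℕ.m≤m+n (q ℕ.* n) (toℕ a))

  closed : Closed F
  closed = ++⁺ (DecimationsIn F) guardeds-closed (λ b → δ-decimations (toℕ b) (Fin.toℕ<n b))
    where
    guardeds-closed : All (DecimationsIn F) (concat guardeds)
    guardeds-closed i = guarded-decimations (toℕ j) (toℕ r) (Fin.toℕ<n j)
      where
      j = proj₁ (remQuot {M} (suc (bound M)) i)
      r = proj₂ (remQuot {M} (suc (bound M)) i)

  isRegular-shift : ∀ {x} → (∀ n → x n ≈ y (r₀ ℕ.+ n)) → IsRegular R q x
  isRegular-shift x≈ = isRegular-Span closed
    (Span-resp (λ n → trans (x≈ n) (reflexive (≡.cong y (index r₀ n)))) (Span-seq z≤n r₀≤))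
    where
    index : ∀ r n → r ℕ.+ n ≡ 1 ℕ.* n ℕ.+ r
    index = solve-∀
    r₀≤ : r₀ ≤ bound 0
    r₀≤ = ℕ.≤-trans (ℕ.m≤n+m r₀ (L ℕ.+ W)) (ℕ.≤-trans (ℕ.m≤n*m H 2) (ℕ.m≤n+m (2 ℕ.* H) 1))

natural-offset : ∀ k .{{_ : ℕ.NonZero k}} l → Σ ℕ λ L → + L ≡ + (k ℕ.* ℤ.∣ l ∣) ℤ.+ l
natural-offset k (+ a)    = k ℕ.* a ℕ.+ a , ℤ.pos-+ (k ℕ.* a) a
natural-offset k -[1+ a ] = k ℕ.* suc a ∸ suc a , ≡.sym (ℤ.⊖-≥ (ℕ.m≤n*m (suc a) k))

m+n⊖m≡n : ∀ m n → (m ℕ.+ n) ⊖ m ≡ + n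
m+n⊖m≡n m n = ≡.trans (ℤ.⊖-≥ (ℕ.m≤m+n m n)) (≡.cong +_ (ℕ.m+n∸m≡n m n))

⊖-offset : ∀ p L i b l → + L ≡ + b ℤ.+ l → (p ℕ.+ L ℕ.+ i) ⊖ b ≡ + p ℤ.+ (l ℤ.+ + i)
⊖-offset p L i b l L≡ = begin
  (p ℕ.+ L ℕ.+ i) ⊖ b                 ≡⟨ ℤ.[+m]-[+n]≡m⊖n (p ℕ.+ L ℕ.+ i) b ⟨
  + (p ℕ.+ L ℕ.+ i) ℤ.- + b            ≡⟨ ≡.cong (ℤ._- + b) (ℤ.pos-+ (p ℕ.+ L) i) ⟩
  + (p ℕ.+ L) ℤ.+ + i ℤ.- + b          ≡⟨ ≡.cong (λ z → z ℤ.+ + i ℤ.- + b) (ℤ.pos-+ p L) ⟩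
  + p ℤ.+ + L ℤ.+ + i ℤ.- + b          ≡⟨ ≡.cong (λ z → + p ℤ.+ z ℤ.+ + i ℤ.- + b) L≡ ⟩
  + p ℤ.+ (+ b ℤ.+ l) ℤ.+ + i ℤ.- + b  ≡⟨ cancel (+ p) (+ b) l (+ i) ⟩
  + p ℤ.+ (l ℤ.+ + i)                  ∎
  where
  open ≡.≡-Reasoning
  cancel : ∀ p b l i → p ℤ.+ (b ℤ.+ l) ℤ.+ i ℤ.- b ≡ p ℤ.+ (l ℤ.+ i)
  cancel = ℤ-Solver.solve-∀

module Delay {c ℓ : Level} (R : CommutativeRing c ℓ) where
  open CommutativeRing R using (Carrier)

  delay : ℕ → (ℕ → Carrier) → ℕ → Carrier
  delay E x k = atℤ R x (k ⊖ E)

  delay-+ : ∀ E x k → delay E x (E ℕ.+ k) ≡ x k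
  delay-+ E x k = ≡.cong (atℤ R x) (m+n⊖m≡n E k)

module DelayedRecurrence {c ℓ : Level} (R : CommutativeRing c ℓ)
  {q M m : ℕ} (2≤q : 2 ≤ q) (m<M : m < M) (l u : ℤ) where
  open CommutativeRing R hiding (zero)
  open Delay R
  open Spans R using (sumFin≡sum)
  open import Algebra.Properties.Semiring.Sum semiring using (sum-cong-≗)

  e E : ℕ
  e = ℤ.∣ l ∣
  E = q ^ M ℕ.* e

  qᵐ<qᴹ : q ^ m < q ^ M
  qᵐ<qᴹ = ℕ.^-monoʳ-< q 2≤q m<M

  instance
    gap≢0 : ℕ.NonZero (q ^ M ∸ q ^ m)
    gap≢0 = ℕ.>-nonZero (ℕ.m<n⇒0<n∸m qᵐ<qᴹ)

  L : ℕ
  L = proj₁ (natural-offset (q ^ M ∸ q ^ m) l)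

  delayed-index : ∀ N i → (q ^ m ℕ.* (e ℕ.+ N) ℕ.+ L ℕ.+ i) ⊖ E ≡ + (q ^ m ℕ.* N) ℤ.+ (l ℤ.+ + i)
  delayed-index N i = begin
    (q ^ m ℕ.* (e ℕ.+ N) ℕ.+ L ℕ.+ i) ⊖ E
      ≡⟨ ≡.cong₂ _⊖_ (regroup (q ^ m) e N L i) E≡ ⟩
    (q ^ m ℕ.* e ℕ.+ (q ^ m ℕ.* N ℕ.+ L ℕ.+ i)) ⊖ (q ^ m ℕ.* e ℕ.+ (q ^ M ∸ q ^ m) ℕ.* e)
      ≡⟨ ℤ.+-cancelˡ-⊖ (q ^ m ℕ.* e) _ _ ⟩
    (q ^ m ℕ.* N ℕ.+ L ℕ.+ i) ⊖ ((q ^ M ∸ q ^ m) ℕ.* e)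
      ≡⟨ ⊖-offset (q ^ m ℕ.* N) L i _ l (proj₂ (natural-offset (q ^ M ∸ q ^ m) l)) ⟩
    + (q ^ m ℕ.* N) ℤ.+ (l ℤ.+ + i)
      ∎
    where
    open ≡.≡-Reasoning
    regroup : ∀ a e N L i → a ℕ.* (e ℕ.+ N) ℕ.+ L ℕ.+ i ≡ a ℕ.* e ℕ.+ (a ℕ.* N ℕ.+ L ℕ.+ i)
    regroup = solve-∀
    E≡ : E ≡ q ^ m ℕ.* e ℕ.+ (q ^ M ∸ q ^ m) ℕ.* e
    E≡ = ≡.trans (≡.cong (ℕ._* e) (≡.sym (ℕ.m+[n∸m]≡n (ℕ.<⇒≤ qᵐ<qᴹ))))
                 (ℕ.*-distribʳ-+ e (q ^ m) (q ^ M ∸ q ^ m))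

  module _ {n₀ : ℕ} {x : ℕ → Carrier} {cs : ℕ → ℤ → Carrier}
    (hyp : ∀ n s → n₀ ≤ n → s < q ^ M →
       x (q ^ M ℕ.* n ℕ.+ s) ≈ sumℤRange R l u (λ k → cs s k * atℤ R x (+ (q ^ m ℕ.* n) ℤ.+ k)))
    where

    delayed-recurrence : ∀ n s → e ℕ.+ n₀ ≤ n → s < q ^ M →
      delay E x (q ^ M ℕ.* n ℕ.+ s) ≈
        sumFin R (suc ℤ.∣ u ℤ.- l ∣) (λ i → cs s (l ℤ.+ + toℕ i) * delay E x (q ^ m ℕ.* n ℕ.+ L ℕ.+ toℕ i))
    delayed-recurrence n s e+n₀≤n s<qᴹ with n ∸ e | ℕ.m+[n∸m]≡n (ℕ.≤-trans (ℕ.m≤m+n e n₀) e+n₀≤n)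
    ... | N | ≡.refl = begin
      delay E x (q ^ M ℕ.* (e ℕ.+ N) ℕ.+ s)
        ≡⟨ ≡.cong (delay E x) (regroup (q ^ M) e N s) ⟩
      delay E x (E ℕ.+ (q ^ M ℕ.* N ℕ.+ s))
        ≡⟨ delay-+ E x (q ^ M ℕ.* N ℕ.+ s) ⟩
      x (q ^ M ℕ.* N ℕ.+ s)
        ≈⟨ hyp N s (ℕ.+-cancelˡ-≤ e n₀ N e+n₀≤n) s<qᴹ ⟩
      sumFin R (suc W) (λ i → cs s (l ℤ.+ + toℕ i) * atℤ R x (+ (q ^ m ℕ.* N) ℤ.+ (l ℤ.+ + toℕ i)))
        ≡⟨ sumFin-cong-≗ (λ i → ≡.cong (λ k → cs s (l ℤ.+ + toℕ i) * atℤ R x k)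
                                       (≡.sym (delayed-index N (toℕ i)))) ⟩
      sumFin R (suc W) (λ i → cs s (l ℤ.+ + toℕ i) * delay E x (q ^ m ℕ.* (e ℕ.+ N) ℕ.+ L ℕ.+ toℕ i))
        ∎
      where
      open import Relation.Binary.Reasoning.Setoid setoid
      W : ℕ
      W = ℤ.∣ u ℤ.- l ∣
      regroup : ∀ Q e N s → Q ℕ.* (e ℕ.+ N) ℕ.+ s ≡ Q ℕ.* e ℕ.+ (Q ℕ.* N ℕ.+ s)
      regroup = solve-∀
      sumFin-cong-≗ : ∀ {f g : Fin (suc W) → Carrier} → (∀ i → f i ≡ g i) →
                      sumFin R (suc W) f ≡ sumFin R (suc W) g
      sumFin-cong-≗ {f} {g} f≗g =
        ≡.trans (sumFin≡sum (suc W) f) (≡.trans (sum-cong-≗ f≗g) (≡.sym (sumFin≡sum (suc W) g)))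

corollary3p11 : ∀ {c ℓ' : Level} (R : CommutativeRing c ℓ') →
    let open CommutativeRing R in
    (q M m : ℕ) (l u : ℤ) (n₀ : ℕ) (x : ℕ → Carrier) (cs : ℕ → ℤ → Carrier) →
    2 ≤ q → m < M → l ℤ.≤ u →
    + 0 ℤ.≤ + (q ^ m ℕ.* n₀) ℤ.+ l →
    (∀ n s → n₀ ≤ n → s < q ^ M →
      x (q ^ M ℕ.* n ℕ.+ s) ≈
        sumℤRange R l u (λ k → cs s k * atℤ R x (+ (q ^ m ℕ.* n) ℤ.+ k))) →
    IsRegular R q x
corollary3p11 R q M m l u n₀ x cs 2≤q m<M _ _ hyp =
  NaturalRecurrence.isRegular-shift R {W = ℤ.∣ u ℤ.- l ∣} 2≤q m<M
    (delay E x) (λ s i → cs s (l ℤ.+ + toℕ i)) (delayed-recurrence {cs = cs} hyp) E (λ n → CommutativeRing.reflexive R (≡.sym (delay-+ E x n)))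
  where
  open Delay R
  open DelayedRecurrence R 2≤q m<M l u
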